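{- In the quasi-consecutive pattern poset, every permutation $\tau$ covers at most three permutations; namely, each permutation covered by $\tau$ is obtained from $\tau$ by removing either its first, its second, or its last entry and standardizing the remaining entries (replacing them by $1,\dots,n-1$ in the same relative order).
   Context: Permutations are written in one-line notation. For permutations $\sigma$ of length $m$ and $\tau=a_1a_2\cdots a_n$ of length $n$, an occurrence of $\sigma$ in $\tau$ (as a quasi-consecutive pattern) is a sequence of positions $1\le i_1<i_2<\cdots<i_m\le n$ such that $i_{j+1}=i_j+1$ for all $2\le j\le m-1$ and $a_{i_1}\cdots a_{i_m}$ is order-isomorphic to $\sigma$ (i.e. $a_{i_s}<a_{i_t}$ iff $\sigma_s<\sigma_t$); thus all entries of the occurrence are adjacent in $\tau$ except possibly the first and second. The quasi-consecutive pattern poset is the set of all finite permutations ordered by $\sigma\le\tau$ iff $\tau$ contains an occurrence of $\sigma$; this is a partial order. $\tau$ covers $\rho$ if $\rho<\tau$ and there is no $\alpha$ with $\rho<\alpha<\tau$; the permutations covered by $\tau$ are exactly the permutations of length $n-1$ that are $\le\tau$. -}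

module Defs where

open import Data.Nat using (ℕ; zero; suc; _+_; _∸_; _<_; _<ᵇ_)
open import Data.Bool using (Bool; true; false; if_then_else_)
open import Data.List using (List; []; _∷_; length; map; upTo; take; drop; zip; lookup; filterᵇ)
open import Data.List.Relation.Binary.Permutation.Propositional using (_↭_)
open import Data.Fin using (Fin)
open import Data.Product using (Σ; _×_; proj₁; proj₂)
open import Data.Sum using (_⊎_)
open import Relation.Binary.PropositionalEquality using (_≡_)
open import Relation.Nullary using (¬_)
open import Function.Bundles using (_⇔_)

IsPerm : List ℕ → Set
IsPerm xs = xs ↭ map suc (upTo (length xs))

OrderIso : List ℕ → List ℕ → Set
OrderIso xs ys =
  length xs ≡ length ys ×
  ((i j : Fin (length (zip xs ys))) →
     (proj₁ (lookup (zip xs ys) i) < proj₁ (lookup (zip xs ys) j))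
       ⇔ (proj₂ (lookup (zip xs ys) i) < proj₂ (lookup (zip xs ys) j)))

-- Quasi-consecutive containment: σ (length m) occurs in τ at positions
-- i₁ < i₂ < i₂+1 < ... < i₂+m-2 (0-based here); the empty pattern occurs trivially.
Contains : List ℕ → List ℕ → Set
Contains σ τ =
  σ ≡ [] ⊎
  Σ (Fin (length τ)) λ i₁ → Σ ℕ λ i₂ →
    (Data.Fin.toℕ i₁ < i₂) ×
    (i₂ + (length σ ∸ 1) Data.Nat.≤ length τ) ×
    OrderIso σ (lookup τ i₁ ∷ take (length σ ∸ 1) (drop i₂ τ))

_≺_ : List ℕ → List ℕ → Set
σ ≺ τ = Contains σ τ × ¬ (σ ≡ τ)

Covers : List ℕ → List ℕ → Set
Covers τ ρ = ρ ≺ τ × ((α : List ℕ) → IsPerm α → ¬ (ρ ≺ α × α ≺ τ))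

count< : ℕ → List ℕ → ℕ
count< x xs = length (filterᵇ (λ y → y <ᵇ x) xs)

standardize : List ℕ → List ℕ
standardize xs = map (λ x → suc (count< x xs)) xs

removeFirst : List ℕ → List ℕ
removeFirst []       = []
removeFirst (_ ∷ xs) = xs

removeSecond : List ℕ → List ℕ
removeSecond (x ∷ _ ∷ xs) = x ∷ xs
removeSecond xs           = xs

removeLast : List ℕ → List ℕ
removeLast []           = []
removeLast (_ ∷ [])     = []
removeLast (x ∷ y ∷ xs) = x ∷ removeLast (y ∷ xs)

module Submission where

-- Let τ cover ρ.  If ρ were as long as τ it would be the
-- standardization of τ, i.e. τ itself.  So ρ is shorter, and (for |τ| ≥ 2)
-- any occurrence of ρ in τ already lies inside one of the three deletions L
-- of τ (first, second or last entry removed); each such L is itself a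
-- quasi-consecutive piece of τ.  Closing the gap left by the deleted entry
-- turns L into a permutation α with the pattern of L, so α < τ.  If ρ were
-- shorter than L we would get ρ < α < τ, contradicting the cover; hence
-- ρ occupies all of L, and a permutation with the pattern of L is
-- standardize L.

open import Defs
open import Data.Bool using (Bool; true; false; if_then_else_; T)
open import Data.Unit using (tt)
open import Data.Empty using (⊥-elim)
open import Data.Product using (Σ; ∃₂; _×_; _,_; proj₁; proj₂)
open import Data.Sum using (_⊎_; inj₁; inj₂)
import Data.Sum as Sum
open import Data.Nat using (ℕ; zero; suc; pred; _+_; _∸_; _≤_; _<_; _<ᵇ_; z≤n; s≤s)
open import Data.Nat.Properties
  using (<ᵇ⇒<; <⇒<ᵇ; +-suc; +-identityʳ; ≤-refl; ≤-reflexive; ≤-trans; ≤-pred; <⇒≤; <⇒≢; ≤⇒≯; <⇒≱; ≮⇒≥;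
         m≤m+n; m≤n+m; n≤1+n; n<1+n; m≤n⇒m≤1+n; m≤n⇒m<n∨m≡n; suc-injective; pred-mono-≤; ∸-monoˡ-≤;
         <-≤-trans; <-trans; <-cmp; ≤-<-connex; _<?_)
open import Data.Fin using (Fin; toℕ) renaming (zero to fzero; suc to fsuc)
open import Data.List
  using (List; []; _∷_; [_]; _++_; length; map; upTo; applyUpTo; zip; filterᵇ; take; drop; lookup)
open import Data.List.Properties
  using (map-applyUpTo; length-map; length-++; map-++; map-id-local; filter-++; filter-all; filter-none;
         take-map; drop-map; take-all)
open import Data.List.Membership.Propositional using (_∈_)
open import Data.List.Membership.Propositional.Properties using (∈-lookup)
open import Data.List.Relation.Unary.All as All using (All)
open import Data.List.Relation.Unary.AllPairs using (_∷_)
open import Data.List.Relation.Unary.Any using (here; there; index)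
open import Data.List.Relation.Unary.Any.Properties using (lookup-index)
open import Data.List.Relation.Unary.Unique.Propositional using (Unique)
import Data.List.Relation.Unary.Unique.Propositional.Properties as Unique
open import Data.List.Relation.Binary.Permutation.Propositional
  using (_↭_; ↭-refl; ↭-trans; ↭-sym; ↭-reflexive; swap; ↭⇒↭ₛ)
open import Data.List.Relation.Binary.Permutation.Propositional.Properties
  using (↭-length; ∈-resp-↭; filter-↭; shift; drop-∷; map⁺; ∷↭∷ʳ)
open import Function using (_∘_)
open import Function.Bundles using (_⇔_; mk⇔; Equivalence)
open import Function.Properties.Equivalence using () renaming (sym to ⇔-sym; trans to ⇔-trans)
open import Relation.Binary.Definitions using (tri<; tri≈; tri>)
open import Relation.Nullary using (¬_; yes; no)
open import Relation.Nullary.Decidable using (T?)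
open import Relation.Binary.PropositionalEquality
  using (_≡_; _≢_; ≢-sym; refl; sym; trans; cong; cong₂; subst; subst₂; module ≡-Reasoning)
  renaming (setoid to ≡-setoid)
open import Data.List.Relation.Binary.Permutation.Setoid.Properties (≡-setoid ℕ) using (Unique-resp-↭)

open Equivalence using (to; from)

<ᵇ⇔< : ∀ {m n} → T (m <ᵇ n) ⇔ m < n
<ᵇ⇔< {m} {n} = mk⇔ (<ᵇ⇒< m n) <⇒<ᵇ

T-injective : ∀ {x y} → (T x ⇔ T y) → x ≡ y
T-injective {false} {false} _ = refl
T-injective {true}  {true}  _ = refl
T-injective {true}  {false} e = ⊥-elim (to e tt)
T-injective {false} {true}  e = ⊥-elim (from e tt)

<ᵇ-cong : ∀ {a b c d} → (a < b ⇔ c < d) → (a <ᵇ b) ≡ (c <ᵇ d)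
<ᵇ-cong e = T-injective (⇔-trans <ᵇ⇔< (⇔-trans e (⇔-sym <ᵇ⇔<)))

-- This avoids the index arithmetic of OrderIso.
Concordant : List (ℕ × ℕ) → Set
Concordant ps = ∀ {p q} → p ∈ ps → q ∈ ps → (proj₁ p < proj₁ q ⇔ proj₂ p < proj₂ q)

orderIso⇒concordant : ∀ {xs ys} → OrderIso xs ys → Concordant (zip xs ys)
orderIso⇒concordant (_ , iso) p∈ q∈ =
  subst₂ (λ p q → proj₁ p < proj₁ q ⇔ proj₂ p < proj₂ q)
    (sym (lookup-index p∈)) (sym (lookup-index q∈)) (iso (index p∈) (index q∈))

concordant⇒orderIso : ∀ {xs ys} → length xs ≡ length ys → Concordant (zip xs ys) → OrderIso xs ys
concordant⇒orderIso len conc = len , λ i j → conc (∈-lookup i) (∈-lookup j)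

zip-∈ʳ : ∀ {xs ys : List ℕ} {a b} → (a , b) ∈ zip xs ys → b ∈ ys
zip-∈ʳ {_ ∷ _} {_ ∷ _} (here refl) = here refl
zip-∈ʳ {_ ∷ _} {_ ∷ _} (there m)   = there (zip-∈ʳ m)

zip-mapʳ-∈ : ∀ {f : ℕ → ℕ} {xs ys : List ℕ} {p} → p ∈ zip xs (map f ys) →
  Σ ℕ λ b → ((proj₁ p , b) ∈ zip xs ys) × (proj₂ p ≡ f b)
zip-mapʳ-∈ {_} {_ ∷ _} {y ∷ _} (here refl) = y , here refl , refl
zip-mapʳ-∈ {f} {_ ∷ xs} {_ ∷ ys} (there m) with zip-mapʳ-∈ {f} {xs} {ys} m
... | b , m′ , e = b , there m′ , e

zip-graph-∈ : ∀ {f : ℕ → ℕ} {ys : List ℕ} {p} → p ∈ zip (map f ys) ys →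
  (proj₁ p ≡ f (proj₂ p)) × (proj₂ p ∈ ys)
zip-graph-∈ {_} {_ ∷ _} (here refl) = refl , here refl
zip-graph-∈ {f} {_ ∷ ys} (there m) with zip-graph-∈ {f} {ys} m
... | e , m′ = e , there m′

OrderEmbeddingOn : (ℕ → ℕ) → List ℕ → Set
OrderEmbeddingOn f ys = ∀ {y y′} → y ∈ ys → y′ ∈ ys → (f y < f y′ ⇔ y < y′)

orderIso-map : ∀ {f xs ys} → OrderEmbeddingOn f ys → OrderIso xs ys → OrderIso xs (map f ys)
orderIso-map {f} {xs} {ys} emb iso =
  concordant⇒orderIso (trans (proj₁ iso) (sym (length-map f ys))) conc
  where
  conc : Concordant (zip xs (map f ys))
  conc p∈ q∈ with zip-mapʳ-∈ {f} {xs} {ys} p∈ | zip-mapʳ-∈ {f} {xs} {ys} q∈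
  ... | b , m , refl | b′ , m′ , refl =
    ⇔-trans (orderIso⇒concordant iso m m′) (⇔-sym (emb (zip-∈ʳ m) (zip-∈ʳ m′)))

orderIso-image : ∀ {f ys} → OrderEmbeddingOn f ys → OrderIso (map f ys) ys
orderIso-image {f} {ys} emb = concordant⇒orderIso (length-map f ys) conc
  where
  conc : Concordant (zip (map f ys) ys)
  conc p∈ q∈ with zip-graph-∈ {f} {ys} p∈ | zip-graph-∈ {f} {ys} q∈
  ... | refl , m | refl , m′ = emb m m′

count : (ℕ → Bool) → List ℕ → ℕ
count p xs = length (filterᵇ p xs)

count-↭ : ∀ p {xs ys} → xs ↭ ys → count p xs ≡ count p ys
count-↭ p xs↭ys = ↭-length (filter-↭ (T? ∘ p) xs↭ys)

count-++ : ∀ p xs ys → count p (xs ++ ys) ≡ count p xs + count p ys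
count-++ p xs ys = trans (cong length (filter-++ (T? ∘ p) xs ys)) (length-++ (filterᵇ p xs))

count-all : ∀ p xs → All (T ∘ p) xs → count p xs ≡ length xs
count-all p _ all = cong length (filter-all (T? ∘ p) all)

count-none : ∀ p xs → All (¬_ ∘ T ∘ p) xs → count p xs ≡ 0
count-none p _ none = cong length (filter-none (T? ∘ p) none)

count-zip : ∀ p q {xs ys} → length xs ≡ length ys →
  (∀ {a b} → (a , b) ∈ zip xs ys → p a ≡ q b) → count p xs ≡ count q ys
count-zip p q {[]}     {[]}     _   _     = refl
count-zip p q {x ∷ xs} {y ∷ ys} len agree
  with p x | q y | agree (here refl) | count-zip p q {xs} {ys} (suc-injective len) (agree ∘ there)
... | true  | true  | _ | ih = cong suc ih
... | false | false | _ | ih = ih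

range : ℕ → ℕ → List ℕ
range a zero    = []
range a (suc n) = a ∷ range (suc a) n

length-range : ∀ a n → length (range a n) ≡ n
length-range a zero    = refl
length-range a (suc n) = cong suc (length-range (suc a) n)

range-bounds : ∀ {x a n} → x ∈ range a n → (a ≤ x) × (x < a + n)
range-bounds {a = a} {suc n} (here refl) = ≤-refl , subst (a <_) (sym (+-suc a n)) (s≤s (m≤m+n a n))
range-bounds {x} {a} {suc n} (there m) with range-bounds m
... | lo , hi = <⇒≤ lo , subst (x <_) (sym (+-suc a n)) hi

range-around : ∀ {x a n} → x ∈ range a n →
  ∃₂ λ k j → (x ≡ a + k) × (range a n ≡ range a k ++ x ∷ range (suc x) j)
range-around {a = a} {suc n} (here refl) = 0 , n , sym (+-identityʳ a) , refl
range-around {x} {a} {suc n} (there m) with range-around m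
... | k , j , refl , split = suc k , j , sym (+-suc a k) , cong (a ∷_) split

range-++ : ∀ a k j → range a k ++ range (a + k) j ≡ range a (k + j)
range-++ a zero    j rewrite +-identityʳ a = refl
range-++ a (suc k) j rewrite +-suc a k     = cong (a ∷_) (range-++ (suc a) k j)

applyUpTo-range : ∀ f a n → (∀ i → f i ≡ a + i) → applyUpTo f n ≡ range a n
applyUpTo-range f a zero    shifted = refl
applyUpTo-range f a (suc n) shifted =
  cong₂ _∷_ (trans (shifted 0) (+-identityʳ a))
    (applyUpTo-range (f ∘ suc) (suc a) n (λ i → trans (shifted (suc i)) (+-suc a i)))

upTo-range : ∀ n → map suc (upTo n) ≡ range 1 n
upTo-range n = trans (map-applyUpTo (λ i → i) suc n) (applyUpTo-range suc 1 n (λ _ → refl))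

perm⇒↭range : ∀ {ρ} → IsPerm ρ → ρ ↭ range 1 (length ρ)
perm⇒↭range {ρ} isPerm = subst (ρ ↭_) (upTo-range (length ρ)) isPerm

↭range⇒perm : ∀ {ρ n} → ρ ↭ range 1 n → IsPerm ρ
↭range⇒perm {ρ} {n} ρ↭ =
  subst (λ m → ρ ↭ map suc (upTo m)) (sym (trans (↭-length ρ↭) (length-range 1 n)))
    (subst (ρ ↭_) (sym (upTo-range n)) ρ↭)

rank-in-perm : ∀ {ρ} → IsPerm ρ → ∀ {r} → r ∈ ρ → suc (count (_<ᵇ r) ρ) ≡ r
rank-in-perm {ρ} isPerm r∈ with range-around (∈-resp-↭ (perm⇒↭range isPerm) r∈)
... | k , j , refl , split = cong suc (begin
  count p ρ                                             ≡⟨ count-↭ p (perm⇒↭range isPerm) ⟩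
  count p (range 1 (length ρ))                          ≡⟨ cong (count p) split ⟩
  count p (range 1 k ++ suc k ∷ range (suc (suc k)) j)  ≡⟨ count-++ p (range 1 k) _ ⟩
  count p (range 1 k) + count p (range (suc k) (suc j)) ≡⟨ cong₂ _+_ smaller larger ⟩
  k + 0                                                 ≡⟨ +-identityʳ k ⟩
  k                                                     ∎)
  where
  open ≡-Reasoning
  p : ℕ → Bool
  p = _<ᵇ suc k
  smaller : count p (range 1 k) ≡ k
  smaller = trans (count-all p (range 1 k) (All.tabulate (λ m → <⇒<ᵇ (proj₂ (range-bounds m)))))
                  (length-range 1 k)
  larger : count p (range (suc k) (suc j)) ≡ 0
  larger = count-none p (range (suc k) (suc j)) (All.tabulate (λ m t → ≤⇒≯ (proj₁ (range-bounds m)) (<ᵇ⇒< _ _ t)))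

standardize-perm : ∀ {ρ} → IsPerm ρ → standardize ρ ≡ ρ
standardize-perm isPerm = map-id-local (All.tabulate (rank-in-perm isPerm))

map-zip-cong : ∀ (f g : ℕ → ℕ) {xs ys} → length xs ≡ length ys →
  (∀ {a b} → (a , b) ∈ zip xs ys → f a ≡ g b) → map f xs ≡ map g ys
map-zip-cong f g {[]}     {[]}     _   _     = refl
map-zip-cong f g {x ∷ xs} {y ∷ ys} len agree =
  cong₂ _∷_ (agree (here refl)) (map-zip-cong f g (suc-injective len) (agree ∘ there))

standardize-orderIso : ∀ {xs ys} → OrderIso xs ys → standardize xs ≡ standardize ys
standardize-orderIso iso = map-zip-cong _ _ (proj₁ iso) λ ab∈ →
  cong suc (count-zip _ _ (proj₁ iso) (λ ab′∈ → <ᵇ-cong (conc ab′∈ ab∈)))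
  where conc = orderIso⇒concordant iso

perm-orderIso⇒standardize : ∀ {ρ xs} → IsPerm ρ → OrderIso ρ xs → ρ ≡ standardize xs
perm-orderIso⇒standardize isPerm iso = trans (sym (standardize-perm isPerm)) (standardize-orderIso iso)

-- Deleting the entry v from a permutation leaves a gap at v; closeGap v
-- closes it by shifting every larger entry down by one.
closeGap : ℕ → ℕ → ℕ
closeGap v y = if v <ᵇ y then pred y else y

closeGap-below : ∀ {v y} → y ≤ v → closeGap v y ≡ y
closeGap-below {v} {y} y≤v with v <ᵇ y in lt
... | false = refl
... | true  = ⊥-elim (≤⇒≯ y≤v (<ᵇ⇒< v y (subst T (sym lt) tt)))

closeGap-above : ∀ {v y} → v < y → closeGap v y ≡ pred y
closeGap-above {v} {y} v<y with v <ᵇ y in lt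
... | true  = refl
... | false = ⊥-elim (subst T lt (<⇒<ᵇ v<y))

closeGap-mono-≤ : ∀ v {y y′} → y ≤ y′ → closeGap v y ≤ closeGap v y′
closeGap-mono-≤ v {y} {y′} y≤y′ with ≤-<-connex y′ v | ≤-<-connex y v
... | inj₁ y′≤v | _ rewrite closeGap-below y′≤v | closeGap-below (≤-trans y≤y′ y′≤v) = y≤y′
... | inj₂ v<y′ | inj₁ y≤v rewrite closeGap-above v<y′ | closeGap-below y≤v = ≤-trans y≤v (pred-mono-≤ v<y′)
... | inj₂ v<y′ | inj₂ v<y rewrite closeGap-above v<y′ | closeGap-above v<y = pred-mono-≤ y≤y′

closeGap-mono-< : ∀ {v y y′} → y ≢ v → y < y′ → closeGap v y < closeGap v y′
closeGap-mono-< {v} {y} {y′} y≢v y<y′ with <-cmp y v | ≤-<-connex y′ v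
... | tri≈ _ y≡v _ | _ = ⊥-elim (y≢v y≡v)
... | tri< y<v _ _ | inj₁ y′≤v rewrite closeGap-below (<⇒≤ y<v) | closeGap-below y′≤v = y<y′
... | tri< y<v _ _ | inj₂ v<y′ rewrite closeGap-below (<⇒≤ y<v) | closeGap-above v<y′ =
  <-≤-trans y<v (pred-mono-≤ v<y′)
... | tri> _ _ v<y | _ rewrite closeGap-above v<y | closeGap-above (<-trans v<y y<y′) = pred-< v<y y<y′
  where
  pred-< : ∀ {v y y′} → v < y → y < y′ → pred y < pred y′
  pred-< {y = suc _} {suc _} _ (s≤s y<y′) = y<y′

closeGap-embedding : ∀ {v L} → All (v ≢_) L → OrderEmbeddingOn (closeGap v) L
closeGap-embedding {v} v∉L {y} {y′} y∈ _ = mk⇔ reflect (closeGap-mono-< (≢-sym (All.lookup v∉L y∈)))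
  where
  reflect : closeGap v y < closeGap v y′ → y < y′
  reflect lt with y <? y′
  ... | yes y<y′ = y<y′
  ... | no  y≮y′ = ⊥-elim (≤⇒≯ (closeGap-mono-≤ v (≮⇒≥ y≮y′)) lt)

perm-distinct : ∀ {τ v L} → IsPerm τ → τ ↭ v ∷ L → All (v ≢_) L
perm-distinct {τ} isPerm split with Unique-resp-↭ (↭⇒↭ₛ (↭-trans (↭-sym isPerm) split)) unique-range
  where
  unique-range : Unique (map suc (upTo (length τ)))
  unique-range = Unique.map⁺ suc-injective (Unique.upTo⁺ (length τ))
... | v∉L ∷ _ = v∉L

deletion-↭range : ∀ {τ v L} → IsPerm τ → τ ↭ v ∷ L → v ∷ L ↭ range 1 (length τ)
deletion-↭range isPerm split = ↭-trans (↭-sym split) (perm⇒↭range isPerm)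

map-closeGap-above : ∀ v a n → v ≤ a → map (closeGap v) (range (suc a) n) ≡ range a n
map-closeGap-above v a zero    v≤a = refl
map-closeGap-above v a (suc n) v≤a =
  cong₂ _∷_ (closeGap-above (s≤s v≤a)) (map-closeGap-above v (suc a) n (m≤n⇒m≤1+n v≤a))

closeGap-perm : ∀ {τ v L} → IsPerm τ → τ ↭ v ∷ L → IsPerm (map (closeGap v) L)
closeGap-perm {τ} {v} {L} isPerm split with range-around (∈-resp-↭ (deletion-↭range isPerm split) (here refl))
... | k , j , refl , around =
  ↭range⇒perm (subst (map (closeGap (suc k)) L ↭_) closed (map⁺ (closeGap (suc k)) L↭))
  where
  open ≡-Reasoning
  L↭ : L ↭ range 1 k ++ range (suc (suc k)) j
  L↭ = drop-∷ (↭-trans (deletion-↭range isPerm split)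
                 (↭-trans (↭-reflexive around) (shift (suc k) (range 1 k) _)))
  closed : map (closeGap (suc k)) (range 1 k ++ range (suc (suc k)) j) ≡ range 1 (k + j)
  closed = begin
    map (closeGap (suc k)) (range 1 k ++ range (suc (suc k)) j)
      ≡⟨ map-++ (closeGap (suc k)) (range 1 k) _ ⟩
    map (closeGap (suc k)) (range 1 k) ++ map (closeGap (suc k)) (range (suc (suc k)) j)
      ≡⟨ cong₂ _++_ (map-id-local (All.tabulate (λ m → closeGap-below (<⇒≤ (proj₂ (range-bounds m))))))
                    (map-closeGap-above (suc k) (suc k) j ≤-refl) ⟩
    range 1 k ++ range (suc k) j
      ≡⟨ range-++ 1 k j ⟩
    range 1 (k + j) ∎

Occurrence : List ℕ → List ℕ → Set
Occurrence σ τ = Σ (Fin (length τ)) λ i₁ → Σ ℕ λ i₂ →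
  (toℕ i₁ < i₂) ×
  (i₂ + (length σ ∸ 1) ≤ length τ) ×
  OrderIso σ (lookup τ i₁ ∷ take (length σ ∸ 1) (drop i₂ τ))

QuasiSublist : List ℕ → List ℕ → Set
QuasiSublist L τ = Σ (Fin (length τ)) λ i₁ → Σ ℕ λ i₂ →
  (toℕ i₁ < i₂) ×
  (i₂ + (length L ∸ 1) ≤ length τ) ×
  (lookup τ i₁ ∷ take (length L ∸ 1) (drop i₂ τ) ≡ L)

quasiSublist-occurrence : ∀ {σ L τ} → QuasiSublist L τ → OrderIso σ L → Occurrence σ τ
quasiSublist-occurrence {σ} {L} {τ} (i₁ , i₂ , i₁<i₂ , bound , sub≡L) iso =
  with-length (length L ∸ 1) (cong (_∸ 1) (proj₁ iso)) bound (subst (OrderIso σ) (sym sub≡L) iso)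
  where
  with-length : ∀ k → length σ ∸ 1 ≡ k → i₂ + k ≤ length τ →
    OrderIso σ (lookup τ i₁ ∷ take k (drop i₂ τ)) → Occurrence σ τ
  with-length _ refl bound′ iso′ = i₁ , i₂ , i₁<i₂ , bound′ , iso′

occurrence-length : ∀ {ρ L} → Occurrence ρ L → length ρ ≤ length L
occurrence-length {[]}     (_ , _ , _ , _ , () , _)
occurrence-length {_ ∷ ρ′} (_ , suc i₂ , _ , bound , _) = ≤-trans (s≤s (m≤n+m (length ρ′) i₂)) bound

occurrence-full : ∀ {ρ L} → Occurrence ρ L → length ρ ≡ length L → OrderIso ρ L
occurrence-full {[]} (_ , _ , _ , _ , () , _) _
occurrence-full {_ ∷ _}  {_ ∷ _} (fzero  , zero , () , _) _
occurrence-full {_ ∷ _}  {_ ∷ _} (fsuc _ , zero , () , _) _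
occurrence-full {_ ∷ _}  {_ ∷ _} (fsuc _ , suc zero , s≤s () , _) _
occurrence-full {ρ@(_ ∷ ρ′)} {c ∷ t} (fzero , suc zero , _ , _ , iso) len =
  subst (OrderIso ρ) (cong (c ∷_) (take-all (length ρ′) t (≤-reflexive (suc-injective (sym len))))) iso
occurrence-full {_ ∷ ρ′} {_ ∷ t} (_ , suc (suc i₂) , _ , bound , _) len =
  ⊥-elim (<⇒≱ (subst (suc (i₂ + length ρ′) ≤_) (suc-injective (sym len)) (≤-pred bound)) (m≤n+m (length ρ′) i₂))

map-position : ∀ (f : ℕ → ℕ) xs (i : Fin (length xs)) →
  Σ (Fin (length (map f xs))) λ i′ → (toℕ i′ ≡ toℕ i) × (lookup (map f xs) i′ ≡ f (lookup xs i))
map-position f (x ∷ xs) fzero    = fzero , refl , refl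
map-position f (x ∷ xs) (fsuc i) with map-position f xs i
... | i′ , same-index , same-entry = fsuc i′ , cong suc same-index , same-entry

take-⊆ : ∀ {x : ℕ} k xs → x ∈ take k xs → x ∈ xs
take-⊆ (suc k) (y ∷ xs) (here x≡y) = here x≡y
take-⊆ (suc k) (y ∷ xs) (there m)  = there (take-⊆ k xs m)

drop-⊆ : ∀ {x : ℕ} k xs → x ∈ drop k xs → x ∈ xs
drop-⊆ zero    xs       m = m
drop-⊆ (suc k) (y ∷ xs) m = there (drop-⊆ k xs m)

occurrence-map : ∀ {ρ L f} → OrderEmbeddingOn f L → Occurrence ρ L → Occurrence ρ (map f L)
occurrence-map {ρ} {L} {f} emb (i₁ , i₂ , i₁<i₂ , bound , iso) with map-position f L i₁
... | i₁′ , same-index , same-entry =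
  i₁′ , i₂ , subst (_< i₂) (sym same-index) i₁<i₂ ,
  subst (i₂ + k ≤_) (sym (length-map f L)) bound ,
  subst (OrderIso ρ) (sym image) (orderIso-map {f} {ρ} {entries} (λ m m′ → emb (entries⊆L m) (entries⊆L m′)) iso)
  where
  k = length ρ ∸ 1
  entries : List ℕ
  entries = lookup L i₁ ∷ take k (drop i₂ L)
  image : lookup (map f L) i₁′ ∷ take k (drop i₂ (map f L)) ≡ map f entries
  image = cong₂ _∷_ same-entry (trans (cong (take k) (drop-map i₂ L)) (take-map k (drop i₂ L)))
  entries⊆L : ∀ {x} → x ∈ entries → x ∈ L
  entries⊆L (here refl) = ∈-lookup i₁
  entries⊆L (there m)   = drop-⊆ i₂ L (take-⊆ k (drop i₂ L) m)

lastOf : ℕ → List ℕ → ℕ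
lastOf x []       = x
lastOf x (y ∷ ys) = lastOf y ys

removeLast-snoc : ∀ x xs → x ∷ xs ≡ removeLast (x ∷ xs) ++ [ lastOf x xs ]
removeLast-snoc x []       = refl
removeLast-snoc x (y ∷ ys) = cong (x ∷_) (removeLast-snoc y ys)

length-removeLast : ∀ x xs → length (removeLast (x ∷ xs)) ≡ length xs
length-removeLast x []       = refl
length-removeLast x (y ∷ ys) = cong suc (length-removeLast y ys)

take-length-removeLast : ∀ xs → take (length (removeLast xs)) xs ≡ removeLast xs
take-length-removeLast []           = refl
take-length-removeLast (x ∷ [])     = refl
take-length-removeLast (x ∷ y ∷ ys) = cong (x ∷_) (take-length-removeLast (y ∷ ys))

take-removeLast : ∀ k xs → k < length xs → take k (removeLast xs) ≡ take k xs
take-removeLast zero    xs           _           = refl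
take-removeLast (suc k) (x ∷ [])     (s≤s ())
take-removeLast (suc k) (x ∷ y ∷ ys) (s≤s k<len) = cong (x ∷_) (take-removeLast k (y ∷ ys) k<len)

record Deletion (τ L : List ℕ) : Set where
  field
    removed  : ℕ
    split    : τ ↭ removed ∷ L
    embedded : QuasiSublist L τ

deleteFirst : ∀ a b t → Deletion (a ∷ b ∷ t) (b ∷ t)
deleteFirst a b t = record
  { removed  = a
  ; split    = ↭-refl
  ; embedded = fsuc fzero , 2 , s≤s (s≤s z≤n) , ≤-refl , cong (b ∷_) (take-all (length t) t ≤-refl)
  }

deleteSecond : ∀ a b t → Deletion (a ∷ b ∷ t) (a ∷ t)
deleteSecond a b t = record
  { removed  = b
  ; split    = swap a b ↭-refl
  ; embedded = fzero , 2 , s≤s z≤n , ≤-refl , cong (a ∷_) (take-all (length t) t ≤-refl)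
  }

deleteLast : ∀ a b t → Deletion (a ∷ b ∷ t) (removeLast (a ∷ b ∷ t))
deleteLast a b t = record
  { removed  = lastOf b t
  ; split    = subst (_↭ lastOf b t ∷ L) (sym (removeLast-snoc a (b ∷ t))) (↭-sym (∷↭∷ʳ (lastOf b t) L))
  ; embedded = fzero , 1 , s≤s z≤n , bound , cong (a ∷_) (take-length-removeLast (b ∷ t))
  }
  where
  L = removeLast (a ∷ b ∷ t)
  bound : suc (length (removeLast (b ∷ t))) ≤ suc (suc (length t))
  bound = s≤s (subst (_≤ suc (length t)) (sym (length-removeLast b t)) (n≤1+n (length t)))

module Compression {τ L} (isPerm : IsPerm τ) (d : Deletion τ L) where
  open Deletion d

  compressed : List ℕ
  compressed = map (closeGap removed) L

  compressed-perm : IsPerm compressed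
  compressed-perm = closeGap-perm isPerm split

  embedding : OrderEmbeddingOn (closeGap removed) L
  embedding = closeGap-embedding (perm-distinct isPerm split)

  compressed-below : compressed ≺ τ
  compressed-below =
    inj₂ (quasiSublist-occurrence {compressed} embedded (orderIso-image {closeGap removed} {L} embedding)) ,
    λ eq → <⇒≢ (n<1+n (length L))
             (trans (sym (length-map (closeGap removed) L)) (trans (cong length eq) (↭-length split)))

NothingBetween : List ℕ → List ℕ → Set
NothingBetween ρ τ = (α : List ℕ) → IsPerm α → ¬ (ρ ≺ α × α ≺ τ)

contains-length : ∀ {ρ L} → Contains ρ L → length ρ ≤ length L
contains-length (inj₁ refl)        = z≤n
contains-length {ρ} {L} (inj₂ occ) = occurrence-length {ρ} {L} occ

contains-same-length : ∀ {ρ L} → IsPerm ρ → Contains ρ L → length ρ ≡ length L → ρ ≡ standardize L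
contains-same-length {L = []}    _      (inj₁ refl) _    = refl
contains-same-length {L = _ ∷ _} _      (inj₁ refl) ()
contains-same-length {ρ} {L}     isPerm (inj₂ occ)  same =
  perm-orderIso⇒standardize isPerm (occurrence-full {ρ} {L} occ same)

-- Otherwise ρ is shorter than L, and the
-- compression of L is a permutation strictly between ρ and τ.
deletion-cover : ∀ {τ ρ L} → IsPerm τ → IsPerm ρ → Deletion τ L →
  Contains ρ L → NothingBetween ρ τ → ρ ≡ standardize L
deletion-cover {τ} {ρ} {L} isPermτ isPermρ d ρ⊑L nothingBetween with m≤n⇒m<n∨m≡n (contains-length {ρ} {L} ρ⊑L)
... | inj₂ same    = contains-same-length isPermρ ρ⊑L same
... | inj₁ shorter =
  ⊥-elim (nothingBetween compressed compressed-perm ((ρ⊑compressed , ρ≢compressed) , compressed-below))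
  where
  open Compression isPermτ d
  ρ⊑compressed : Contains ρ compressed
  ρ⊑compressed = Sum.map₂ (occurrence-map {ρ} {L} embedding) ρ⊑L
  ρ≢compressed : ρ ≢ compressed
  ρ≢compressed eq = <⇒≢ shorter (trans (cong length eq) (length-map _ L))

locate : ∀ {ρ a b t} → Contains ρ (a ∷ b ∷ t) → length ρ < length (a ∷ b ∷ t) →
  Contains ρ (b ∷ t) ⊎ Contains ρ (a ∷ t) ⊎ Contains ρ (removeLast (a ∷ b ∷ t))
locate (inj₁ ρ≡[]) _ = inj₁ (inj₁ ρ≡[])
locate (inj₂ (fsuc i₁ , suc i₂ , s≤s i₁<i₂ , bound , iso)) _ =
  inj₁ (inj₂ (i₁ , i₂ , i₁<i₂ , ≤-pred bound , iso))
locate (inj₂ (fzero , suc (suc i₂) , _ , bound , iso)) _ =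
  inj₂ (inj₁ (inj₂ (fzero , suc i₂ , s≤s z≤n , ≤-pred bound , iso)))
locate {ρ} {a} {b} {t} (inj₂ (fzero , suc zero , _ , _ , iso)) shorter =
  inj₂ (inj₂ (inj₂ (fzero , 1 , s≤s z≤n , s≤s bound , subst (λ xs → OrderIso ρ (a ∷ xs)) (sym same-prefix) iso)))
  where
  k = length ρ ∸ 1
  k<len : k < length (b ∷ t)
  k<len = s≤s (∸-monoˡ-≤ 1 (≤-pred shorter))
  bound : k ≤ length (removeLast (b ∷ t))
  bound = subst (k ≤_) (sym (length-removeLast b t)) (≤-pred k<len)
  same-prefix : take k (removeLast (b ∷ t)) ≡ take k (b ∷ t)
  same-prefix = take-removeLast k (b ∷ t) k<len
locate (inj₂ (fzero  , zero , () , _))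
locate (inj₂ (fsuc _ , zero , () , _))

proposition3p1 : (τ ρ : List ℕ) → IsPerm τ → IsPerm ρ → Covers τ ρ →
    (ρ ≡ standardize (removeFirst τ)) ⊎
    (ρ ≡ standardize (removeSecond τ)) ⊎
    (ρ ≡ standardize (removeLast τ))
proposition3p1 τ ρ isPermτ isPermρ ((ρ⊑τ , ρ≢τ) , nothingBetween) with m≤n⇒m<n∨m≡n (contains-length {ρ} {τ} ρ⊑τ)
... | inj₂ same = ⊥-elim (ρ≢τ (trans (contains-same-length isPermρ ρ⊑τ same) (standardize-perm isPermτ)))
proposition3p1 []          ρ       _ _ _ | inj₁ ()
proposition3p1 (a ∷ [])    []      _ _ _ | inj₁ _ = inj₁ refl
proposition3p1 (a ∷ [])    (_ ∷ _) _ _ _ | inj₁ (s≤s ())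
proposition3p1 (a ∷ b ∷ t) ρ isPermτ isPermρ ((ρ⊑τ , _) , nothingBetween) | inj₁ shorter =
  Sum.map (cover (deleteFirst a b t)) (Sum.map (cover (deleteSecond a b t)) (cover (deleteLast a b t)))
    (locate ρ⊑τ shorter)
  where
  cover : ∀ {L} → Deletion (a ∷ b ∷ t) L → Contains ρ L → ρ ≡ standardize L
  cover d ρ⊑L = deletion-cover isPermτ isPermρ d ρ⊑L nothingBetween
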